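{- Let $P$ be $\mathbb{N}\times\mathbb{N}$ ordered by the reverse of the product order (i.e. $\langle a_1,a_2\rangle\leq\langle b_1,b_2\rangle$ iff $a_1\geq b_1$ and $a_2\geq b_2$). Then the only right-regular band operation admissible for $P$ is the infimum operation of $P$.
   Context: A right-regular band operation is an associative binary operation satisfying $x\cdot x=x$ and $x\cdot y\cdot x=y\cdot x$. It is admissible for a partial order $\leq$ if for all $x,y$: $x\leq y\iff x\cdot y=x$. -}

module Defs where

open import Data.Nat using (ℕ; _≤_)
open import Data.Product using (_×_; _,_)
open import Relation.Binary.PropositionalEquality using (_≡_)
open import Function.Bundles using (_⇔_)

P : Set
P = ℕ × ℕ

_≤P_ : P → P → Set
(a₁ , a₂) ≤P (b₁ , b₂) = (b₁ ≤ a₁) × (b₂ ≤ a₂)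

record IsRightRegularBand {A : Set} (_·_ : A → A → A) : Set where
  field
    assoc    : ∀ x y z → (x · y) · z ≡ x · (y · z)
    idem     : ∀ x → x · x ≡ x
    rightReg : ∀ x y → (x · y) · x ≡ y · x

Admissible : {A : Set} → (A → A → Set) → (A → A → A) → Set
Admissible _≼_ _·_ = ∀ x y → (x ≼ y) ⇔ ((x · y) ≡ x)

IsInfimum : {A : Set} → (A → A → Set) → A → A → A → Set
IsInfimum _≼_ x y m = (m ≼ x) × (m ≼ y) × (∀ z → z ≼ x → z ≼ y → z ≼ m)

{-# OPTIONS --safe #-}
-- An admissible band operation always satisfies x · y ≤ y and lies above every
-- common lower bound of x and y; what is special to P is x · y ≤ x.  Write
-- x = (a₁ , a₂), y = (b₁ , b₂), u = x · y and suppose b₂ ≤ a₂ (otherwise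
-- a₂ ≤ b₂ ≤ u₂ already).  The point z = (1 + u₁ , u₂) lies below u, so
-- w = z · x satisfies w · y = z · u = z.  As z₁ > b₁ but z₁ ≤ w₁ ⊔ b₁, also
-- w ≤ y, so w = w · y = z, and w ≤ x gives a₂ ≤ u₂.  The other
-- coordinate follows by conjugating the operation with the swap of coordinates.
module Submission where

open import Defs
open import Data.Nat using (suc; _≤_; _<_; _⊔_; s≤s)
open import Data.Nat.Properties using (≤-refl; ≤-trans; ≤-total; <-≤-trans; <⇒≤; n≤1+n; m≤m⊔n; m≤n⊔m; ⊔-sel; <-irrefl)
open import Data.Product using (_,_; proj₁; proj₂; swap)
open import Data.Sum using (inj₁; inj₂)
open import Data.Empty using (⊥-elim)
open import Function.Bundles using (Equivalence; mk⇔)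
open import Relation.Binary.PropositionalEquality using (_≡_; refl; sym; trans; cong; subst)

n<m⊔n⇒n<m : ∀ {m n} → n < m ⊔ n → n < m
n<m⊔n⇒n<m {m} {n} n<m⊔n with ⊔-sel m n
... | inj₁ m⊔n≡m = subst (n <_) m⊔n≡m n<m⊔n
... | inj₂ m⊔n≡n = ⊥-elim (<-irrefl refl (subst (n <_) m⊔n≡n n<m⊔n))

module _ {A : Set} {_≼_ : A → A → Set} {_·_ : A → A → A}
         (band : IsRightRegularBand _·_) (admissible : Admissible _≼_ _·_) where

  open IsRightRegularBand band

  ≼⇒·≡ : ∀ {x y} → x ≼ y → x · y ≡ x
  ≼⇒·≡ {x} {y} = Equivalence.to (admissible x y)

  ·≡⇒≼ : ∀ {x y} → x · y ≡ x → x ≼ y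
  ·≡⇒≼ {x} {y} = Equivalence.from (admissible x y)

  x·y≼y : ∀ x y → (x · y) ≼ y
  x·y≼y x y = ·≡⇒≼ (trans (assoc x y y) (cong (x ·_) (idem y)))

  ·-greatest : ∀ {x y z} → z ≼ x → z ≼ y → z ≼ (x · y)
  ·-greatest {x} {y} {z} z≼x z≼y =
    ·≡⇒≼ (trans (sym (assoc z x y)) (trans (cong (_· y) (≼⇒·≡ z≼x)) (≼⇒·≡ z≼y)))

swapped : (P → P → P) → P → P → P
swapped _·_ x y = swap (swap x · swap y)

swapped-isRightRegularBand : ∀ {_·_} → IsRightRegularBand _·_ → IsRightRegularBand (swapped _·_)
swapped-isRightRegularBand band = record
  { assoc    = λ x y z → cong swap (assoc (swap x) (swap y) (swap z))
  ; idem     = λ x → cong swap (idem (swap x))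
  ; rightReg = λ x y → cong swap (rightReg (swap x) (swap y))
  }
  where open IsRightRegularBand band

swapped-admissible : ∀ {_·_} → Admissible _≤P_ _·_ → Admissible _≤P_ (swapped _·_)
swapped-admissible admissible x y = mk⇔
  (λ x≤y → cong swap (Equivalence.to (admissible (swap x) (swap y)) (swap x≤y)))
  (λ x·y≡x → swap (Equivalence.from (admissible (swap x) (swap y)) (cong swap x·y≡x)))

module _ {_·_ : P → P → P} (band : IsRightRegularBand _·_) (admissible : Admissible _≤P_ _·_) where

  open IsRightRegularBand band

  proj₁-·-≤-⊔ : ∀ x y → proj₁ (x · y) ≤ proj₁ x ⊔ proj₁ y
  proj₁-·-≤-⊔ (a₁ , a₂) (b₁ , b₂) = proj₁ (·-greatest band admissible
    (m≤m⊔n a₁ b₁ , m≤m⊔n a₂ b₂) (m≤n⊔m a₁ b₁ , m≤n⊔m a₂ b₂))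

  w·y≡z⇒w≡z : ∀ {w y z} → w · y ≡ z → proj₁ y < proj₁ z → proj₂ y ≤ proj₂ w → w ≡ z
  w·y≡z⇒w≡z {w} {y} w·y≡z y₁<z₁ y₂≤w₂ = trans (sym (≼⇒·≡ band admissible w≤y)) w·y≡z
    where
    y₁<w₁⊔y₁ : proj₁ y < proj₁ w ⊔ proj₁ y
    y₁<w₁⊔y₁ = <-≤-trans y₁<z₁ (subst (λ t → proj₁ t ≤ _) w·y≡z (proj₁-·-≤-⊔ w y))

    w≤y : w ≤P y
    w≤y = <⇒≤ (n<m⊔n⇒n<m y₁<w₁⊔y₁) , y₂≤w₂

  proj₂-≤-· : ∀ x y → proj₂ x ≤ proj₂ (x · y)
  proj₂-≤-· x y with ≤-total (proj₂ y) (proj₂ x)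
  ... | inj₂ x₂≤y₂ = ≤-trans x₂≤y₂ (proj₂ (x·y≼y band admissible x y))
  ... | inj₁ y₂≤x₂ = subst (λ t → proj₂ x ≤ proj₂ t) w≡z (proj₂ w≤x)
    where
    u = x · y
    z = (suc (proj₁ u) , proj₂ u)
    w = z · x

    w≤x : w ≤P x
    w≤x = x·y≼y band admissible z x

    w·y≡z : w · y ≡ z
    w·y≡z = trans (assoc z x y) (≼⇒·≡ band admissible (n≤1+n (proj₁ u) , ≤-refl))

    w≡z : w ≡ z
    w≡z = w·y≡z⇒w≡z w·y≡z (s≤s (proj₁ (x·y≼y band admissible x y))) (≤-trans y₂≤x₂ (proj₂ w≤x))

x·y≤Px : ∀ {_·_} → IsRightRegularBand _·_ → Admissible _≤P_ _·_ → ∀ x y → (x · y) ≤P x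
x·y≤Px band admissible x y =
  proj₂-≤-· (swapped-isRightRegularBand band) (swapped-admissible admissible) (swap x) (swap y) ,
  proj₂-≤-· band admissible x y

corollary5p6 : (_·_ : P → P → P) → IsRightRegularBand _·_ → Admissible _≤P_ _·_ →
                 ∀ x y → IsInfimum _≤P_ x y (x · y)
corollary5p6 _·_ band admissible x y =
  x·y≤Px band admissible x y , x·y≼y band admissible x y ,
  λ _ → ·-greatest band admissible
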